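{- Let $V$ be a finite set with $v$ elements, let $k,t$ be non-negative integers with $t\leq \min(k,v-k)$, and let $G$ and $G'$ be two graphs on $V$. If $G$ and $G'$ are $k$-hypomorphic up to complementation, then they are $t$-hypomorphic up to complementation.
   Context: A graph is a pair $G=(V,E)$ with $E$ a set of 2-element subsets of $V$; $\overline G$ denotes its complement and $G_{\restriction K}$ the subgraph induced on $K\subseteq V$. Two graphs are isomorphic up to complementation if one is isomorphic to the other or to its complement. $G,G'$ on $V$ are $k$-hypomorphic up to complementation if for every $k$-element $K\subseteq V$, $G_{\restriction K}$ and $G'_{\restriction K}$ are isomorphic up to complementation. -}

module Defs where

open import Data.Nat using (ℕ)
open import Data.Bool using (Bool; not)
open import Data.Fin using (Fin)
open import Data.Fin.Subset using (Subset; _∈_; ∣_∣)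
open import Data.Product using (Σ; _×_; proj₁)
open import Data.Sum using (_⊎_)
open import Function.Bundles using (_↔_; Inverse)
open import Relation.Binary.PropositionalEquality using (_≡_; _≢_; cong)
open import Data.Bool.Properties using ()

-- Its edge set E (a set of 2-element subsets of V) is given by a symmetric
-- characteristic function; the value on the diagonal pairs (x , x) is
-- irrelevant (it never corresponds to a 2-element subset) and is ignored
-- by every notion below.
record Graph (v : ℕ) : Set where
  field
    adj : Fin v → Fin v → Bool
    sym : ∀ x y → adj x y ≡ adj y x
open Graph public

complement : ∀ {v} → Graph v → Graph v
complement G = record
  { adj = λ x y → not (adj G x y)
  ; sym = λ x y → cong not (sym G x y)
  }

Elem : ∀ {v} → Subset v → Set
Elem {v} K = Σ (Fin v) (λ x → x ∈ K)

InducedIso : ∀ {v} → Graph v → Graph v → Subset v → Set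
InducedIso G H K =
  Σ (Elem K ↔ Elem K) λ f →
    ∀ (x y : Elem K) → proj₁ x ≢ proj₁ y →
      adj G (proj₁ x) (proj₁ y)
        ≡ adj H (proj₁ (Inverse.to f x)) (proj₁ (Inverse.to f y))

InducedIsoUpToCompl : ∀ {v} → Graph v → Graph v → Subset v → Set
InducedIsoUpToCompl G H K = InducedIso G H K ⊎ InducedIso G (complement H) K

HypomorphicUpToCompl : ∀ {v} → ℕ → Graph v → Graph v → Set
HypomorphicUpToCompl k G H =
  ∀ (K : Subset _) → ∣ K ∣ ≡ k → InducedIsoUpToCompl G H K

module Submission where

-- Fix the t-set T₀ and let copies H T be 1 if H|T is isomorphic to G|T₀ up to
-- complementation and 0 otherwise.  An isomorphism up to complementation between G|K and
-- G'|K permutes the subsets of K and carries the copies for G onto those for G'.  Hence,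
-- with up f K = Σ_{x ∈ K} f (K - x), the function upⁿ (k - t) (copies G - copies G')
-- vanishes on every k-set.  For t ≤ min(k, v - k) the iterate upⁿ (k - t) is injective on
-- functions supported on t-sets (Gottlieb-Kantor), which follows from the commutation
-- relation down ∘ up - up ∘ down = v - 2s on functions supported on s-sets.  So
-- copies G' T₀ = copies G T₀ = 1.

open import Defs hiding (sym)
open import Data.Bool using (Bool; true; false; not; _xor_)
import Data.Bool.Properties as BoolP
open import Data.Fin as Fin using (Fin; zero; suc)
import Data.Fin.Properties as FinP
open import Data.Fin.Permutation as Perm
  using (Permutation′; permutation; _⟨$⟩ʳ_; _⟨$⟩ˡ_; _∘ₚ_; flip; inverseˡ; inverseʳ)
import Data.Fin.Subset as Subset
open import Data.Fin.Subset using (Subset; ∣_∣; _∈_; _∉_; _⊆_)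
open import Data.Fin.Subset.Properties using (_∈?_; ⊆-trans; x∈p⇒∣p-x∣<∣p∣)
open import Data.Integer as ℤ using (ℤ; +_; _+_; _*_; -_; _-_; 0ℤ; 1ℤ; -1ℤ)
import Data.Integer.Properties as ℤP
open import Data.Integer.Tactic.RingSolver using (solve-∀)
open import Data.Nat as ℕ using (ℕ; zero; suc; _≤_; _∸_; _⊓_)
import Data.Nat.Properties as ℕP
open import Data.Nat.Tactic.RingSolver renaming (solve-∀ to ℕ-solve-∀)
open import Data.Product using (Σ; ∃; ∃₂; _×_; _,_; proj₁; proj₂)
open import Data.Sum using (inj₁; inj₂)
open import Data.Vec using (Vec; []; _∷_; lookup; tabulate; _[_]≔_)
import Data.Vec.Properties as VecP
open import Data.Vec.Properties.WithK using ([]=-irrelevant)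
open import Function using (_∘_; const; flip′)
open import Function.Bundles using (_↔_; Inverse; Injection; mk↔ₛ′)
open import Function.Properties.Inverse using (↔⇒↣)
open import Relation.Binary.PropositionalEquality
open import Relation.Nullary using (Dec; yes; no; does; contradiction; ¬?; _×-dec_; _→-dec_; _⊎-dec_)
open import Relation.Nullary.Decidable using (map′; dec-true; dec-false)

open import Algebra.Properties.CommutativeSemigroup ℤP.*-commutativeSemigroup using (x∙yz≈y∙xz)
open import Algebra.Properties.Semiring.Sum ℤP.+-*-semiring
  using (sum; sum-cong-≗; sum-replicate-zero; ∑-distrib-+; ∑-comm; sum-permute; *-distribˡ-sum; *-distribʳ-sum)

⟦_⟧ : Bool → ℤ
⟦ true ⟧ = 1ℤ
⟦ false ⟧ = 0ℤ

⟦⟧*-cong : ∀ b {u w : ℤ} → (b ≡ true → u ≡ w) → ⟦ b ⟧ * u ≡ ⟦ b ⟧ * w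
⟦⟧*-cong true u≡w = cong (1ℤ *_) (u≡w refl)
⟦⟧*-cong false u≡w = refl

⟦⟧*-vanishing : ∀ b {u : ℤ} → (b ≡ true → u ≡ 0ℤ) → ⟦ b ⟧ * u ≡ 0ℤ
⟦⟧*-vanishing b u≡0 = trans (⟦⟧*-cong b u≡0) (ℤP.*-zeroʳ ⟦ b ⟧)

⟦not⟧ : ∀ b → ⟦ not b ⟧ ≡ 1ℤ - ⟦ b ⟧
⟦not⟧ true = refl
⟦not⟧ false = refl

⟦does⟧≡1⇒ : ∀ {A : Set} (a? : Dec A) → ⟦ does a? ⟧ ≡ 1ℤ → A
⟦does⟧≡1⇒ (yes a) _ = a
⟦does⟧≡1⇒ (no _) ()

∃-Bool? : ∀ {P : Bool → Set} → (∀ b → Dec (P b)) → Dec (∃ P)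
∃-Bool? P? = map′ (λ { (inj₁ p) → true , p ; (inj₂ p) → false , p })
                  (λ { (true , p) → inj₁ p ; (false , p) → inj₂ p })
                  (P? true ⊎-dec P? false)

does-⇔ : ∀ {A B : Set} → (A → B) → (B → A) → (a? : Dec A) (b? : Dec B) → does a? ≡ does b?
does-⇔ A→B B→A (yes a) b? = sym (dec-true b? (A→B a))
does-⇔ A→B B→A (no ¬a) b? = sym (dec-false b? (¬a ∘ B→A))

sum-vanishing : ∀ {n} {f : Fin n → ℤ} → (∀ i → f i ≡ 0ℤ) → sum f ≡ 0ℤ
sum-vanishing {n} f≡0 = trans (sum-cong-≗ f≡0) (sum-replicate-zero n)

∑-distrib-minus : ∀ {n} (f g : Fin n → ℤ) → sum (λ i → f i - g i) ≡ sum f - sum g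
∑-distrib-minus f g = begin
  sum (λ i → f i - g i)         ≡⟨ ∑-distrib-+ f (λ i → - g i) ⟩
  sum f + sum (λ i → - g i)     ≡⟨ cong (_+_ (sum f)) (sum-cong-≗ (λ i → sym (ℤP.-1*i≡-i (g i)))) ⟩
  sum f + sum (λ i → -1ℤ * g i) ≡⟨ cong (_+_ (sum f)) (*-distribˡ-sum -1ℤ g) ⟨
  sum f + -1ℤ * sum g           ≡⟨ cong (_+_ (sum f)) (ℤP.-1*i≡-i (sum g)) ⟩
  sum f - sum g                 ∎
  where open ≡-Reasoning

∑-δ : ∀ {n} (x : Fin n) (f : Fin n → ℤ) → sum (λ y → ⟦ does (x Fin.≟ y) ⟧ * f y) ≡ f x
∑-δ {suc n} zero f = begin
  1ℤ * f zero + sum (λ y → 0ℤ * f (suc y))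
    ≡⟨ cong₂ _+_ (ℤP.*-identityˡ (f zero)) (sum-vanishing {n} (λ _ → refl)) ⟩
  f zero + 0ℤ
    ≡⟨ ℤP.+-identityʳ (f zero) ⟩
  f zero
    ∎
  where open ≡-Reasoning
∑-δ {suc n} (suc x) f = trans (ℤP.+-identityˡ _) (∑-δ x (f ∘ suc))

∑-*-+ : ∀ {n} (c : Fin n → ℤ) a (h : Fin n → ℤ) →
        sum (λ x → c x * (a + h x)) ≡ sum c * a + sum (λ x → c x * h x)
∑-*-+ {n} c a h = begin
  sum (λ x → c x * (a + h x))                 ≡⟨ sum-cong-≗ (λ x → ℤP.*-distribˡ-+ (c x) a (h x)) ⟩
  sum (λ x → c x * a + c x * h x)             ≡⟨ ∑-distrib-+ {n} _ _ ⟩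
  sum (λ x → c x * a) + sum (λ x → c x * h x) ≡⟨ cong (_+ sum (λ x → c x * h x)) (*-distribʳ-sum a c) ⟨
  sum c * a + sum (λ x → c x * h x)           ∎
  where open ≡-Reasoning

∑-*-∑-comm : ∀ {n} (a b : Fin n → ℤ) (h : Fin n → Fin n → ℤ) →
             sum (λ y → b y * sum (λ x → a x * h x y)) ≡ sum (λ x → a x * sum (λ y → b y * h x y))
∑-*-∑-comm {n} a b h = begin
  sum (λ y → b y * sum (λ x → a x * h x y))
    ≡⟨ sum-cong-≗ (λ y → *-distribˡ-sum (b y) (λ x → a x * h x y)) ⟩
  sum (λ y → sum (λ x → b y * (a x * h x y)))
    ≡⟨ ∑-comm {n} {n} _ ⟩
  sum (λ x → sum (λ y → b y * (a x * h x y)))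
    ≡⟨ sum-cong-≗ (λ x → sum-cong-≗ (λ y → x∙yz≈y∙xz (b y) (a x) (h x y))) ⟩
  sum (λ x → sum (λ y → a x * (b y * h x y)))
    ≡⟨ sum-cong-≗ (λ x → *-distribˡ-sum (a x) (λ y → b y * h x y)) ⟨
  sum (λ x → a x * sum (λ y → b y * h x y))
    ∎
  where open ≡-Reasoning

count-∈ : ∀ {n} (S : Subset n) → sum (λ x → ⟦ lookup S x ⟧) ≡ + ∣ S ∣
count-∈ [] = refl
count-∈ (true ∷ S) = cong (_+_ 1ℤ) (count-∈ S)
count-∈ (false ∷ S) = trans (ℤP.+-identityˡ _) (count-∈ S)

count-∉ : ∀ {n} (S : Subset n) → sum (λ x → ⟦ not (lookup S x) ⟧) ≡ + n - + ∣ S ∣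
count-∉ {n} S = begin
  sum (λ x → ⟦ not (lookup S x) ⟧)                 ≡⟨ sum-cong-≗ (⟦not⟧ ∘ lookup S) ⟩
  sum (λ x → 1ℤ - ⟦ lookup S x ⟧)                  ≡⟨ ∑-distrib-minus {n} (const 1ℤ) (⟦_⟧ ∘ lookup S) ⟩
  sum {n} (const 1ℤ) - sum (λ x → ⟦ lookup S x ⟧) ≡⟨ cong₂ _-_ (sum-1 n) (count-∈ S) ⟩
  + n - + ∣ S ∣                                    ∎
  where
  open ≡-Reasoning
  sum-1 : ∀ n → sum {n} (const 1ℤ) ≡ + n
  sum-1 zero = refl
  sum-1 (suc n) = cong (_+_ 1ℤ) (sum-1 n)

[]≔-fixed : ∀ {n} (S : Subset n) x {b} → lookup S x ≡ b → S [ x ]≔ b ≡ S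
[]≔-fixed S x refl = VecP.[]≔-lookup S x

∣[]≔true∣ : ∀ {n} (S : Subset n) x → ∣ S [ x ]≔ true ∣ ≡ suc ∣ S [ x ]≔ false ∣
∣[]≔true∣ (b ∷ S) zero = refl
∣[]≔true∣ (true ∷ S) (suc x) = cong suc (∣[]≔true∣ S x)
∣[]≔true∣ (false ∷ S) (suc x) = ∣[]≔true∣ S x

∣insert∣ : ∀ {n} (S : Subset n) x → lookup S x ≡ false → ∣ S [ x ]≔ true ∣ ≡ suc ∣ S ∣
∣insert∣ S x x∉S = trans (∣[]≔true∣ S x) (cong (suc ∘ ∣_∣) ([]≔-fixed S x x∉S))

∣remove∣ : ∀ {n} (S : Subset n) x → lookup S x ≡ true → ∣ S ∣ ≡ suc ∣ S [ x ]≔ false ∣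
∣remove∣ S x x∈S = trans (cong ∣_∣ (sym ([]≔-fixed S x x∈S))) (∣[]≔true∣ S x)

[]≔false-⊆ : ∀ {n} (K : Subset n) x → K [ x ]≔ false ⊆ K
[]≔false-⊆ K x {y} y∈K-x with y Fin.≟ x
... | yes refl = contradiction (trans (sym (VecP.lookup∘update x K false)) (VecP.[]=⇒lookup y∈K-x)) λ ()
... | no y≢x = VecP.lookup⇒[]= y K (trans (sym (VecP.lookup∘update′ y≢x K false)) (VecP.[]=⇒lookup y∈K-x))

lookup-ext : ∀ {n} {S T : Subset n} → lookup S ≗ lookup T → S ≡ T
lookup-ext {S = S} {T} S≗T =
  trans (sym (VecP.tabulate∘lookup S)) (trans (VecP.tabulate-cong S≗T) (VecP.tabulate∘lookup T))

up : ∀ {v} → (Subset v → ℤ) → Subset v → ℤ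
up f K = sum (λ x → ⟦ lookup K x ⟧ * f (K [ x ]≔ false))

down : ∀ {v} → (Subset v → ℤ) → Subset v → ℤ
down f S = sum (λ x → ⟦ not (lookup S x) ⟧ * f (S [ x ]≔ true))

upⁿ : ∀ {v} → ℕ → (Subset v → ℤ) → Subset v → ℤ
upⁿ zero f = f
upⁿ (suc m) f = up (upⁿ m f)

up-cong : ∀ {v} {f g : Subset v → ℤ} → f ≗ g → up f ≗ up g
up-cong f≗g K = sum-cong-≗ (λ x → cong (⟦ lookup K x ⟧ *_) (f≗g _))

up-+ : ∀ {v} (f g : Subset v → ℤ) K → up (λ S → f S + g S) K ≡ up f K + up g K
up-+ {v} f g K = trans (sum-cong-≗ {v} (λ x → ℤP.*-distribˡ-+ ⟦ lookup K x ⟧ _ _)) (∑-distrib-+ {v} _ _)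

up-* : ∀ {v} c (f : Subset v → ℤ) K → up (λ S → c * f S) K ≡ c * up f K
up-* {v} c f K = trans (sum-cong-≗ {v} (λ x → x∙yz≈y∙xz ⟦ lookup K x ⟧ c _))
                       (sym (*-distribˡ-sum c (λ x → ⟦ lookup K x ⟧ * f (K [ x ]≔ false))))

up-vanishing : ∀ {v} {f : Subset v → ℤ} → f ≗ const 0ℤ → up f ≗ const 0ℤ
up-vanishing f≗0 K = sum-vanishing (λ x → ⟦⟧*-vanishing (lookup K x) (λ _ → f≗0 _))

upⁿ-vanishing : ∀ {v} m {f : Subset v → ℤ} → f ≗ const 0ℤ → upⁿ m f ≗ const 0ℤ
upⁿ-vanishing zero f≗0 = f≗0
upⁿ-vanishing (suc m) f≗0 = up-vanishing (upⁿ-vanishing m f≗0)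

down-vanishing : ∀ {v} {f : Subset v → ℤ} → f ≗ const 0ℤ → down f ≗ const 0ℤ
down-vanishing f≗0 S = sum-vanishing (λ x → ⟦⟧*-vanishing (not (lookup S x)) (λ _ → f≗0 _))

upⁿ-distrib-minus : ∀ {v} m (f g : Subset v → ℤ) K →
                    upⁿ m (λ S → f S - g S) K ≡ upⁿ m f K - upⁿ m g K
upⁿ-distrib-minus zero f g K = refl
upⁿ-distrib-minus {v} (suc m) f g K = begin
  up (upⁿ m (λ S → f S - g S)) K
    ≡⟨ up-cong (upⁿ-distrib-minus m f g) K ⟩
  up (λ S → upⁿ m f S - upⁿ m g S) K
    ≡⟨ sum-cong-≗ (λ x → *-distribˡ-minus ⟦ lookup K x ⟧ _ _) ⟩
  sum (λ x → ⟦ lookup K x ⟧ * upⁿ m f (K [ x ]≔ false) - ⟦ lookup K x ⟧ * upⁿ m g (K [ x ]≔ false))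
    ≡⟨ ∑-distrib-minus {v} _ _ ⟩
  up (upⁿ m f) K - up (upⁿ m g) K
    ∎
  where
  open ≡-Reasoning
  *-distribˡ-minus : ∀ a b c → a * (b - c) ≡ a * b - a * c
  *-distribˡ-minus = solve-∀

upⁿ-local : ∀ {v} m {f g : Subset v → ℤ} {K} → (∀ {T} → T ⊆ K → f T ≡ g T) →
            upⁿ m f K ≡ upⁿ m g K
upⁿ-local zero agree = agree (λ x∈K → x∈K)
upⁿ-local (suc m) {K = K} agree = sum-cong-≗ λ x →
  cong (⟦ lookup K x ⟧ *_) (upⁿ-local m (λ T⊆K-x → agree (⊆-trans T⊆K-x ([]≔false-⊆ K x))))

module _ {v} (g : Subset v → ℤ) (S : Subset v) where

  private
    exchange : Fin v → Fin v → ℤ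
    exchange x y = g ((S [ y ]≔ false) [ x ]≔ true)

  up-after-insert : ∀ x → lookup S x ≡ false →
                    up g (S [ x ]≔ true) ≡ g S + sum (λ y → ⟦ lookup S y ⟧ * exchange x y)
  up-after-insert x x∉S = begin
    up g (S [ x ]≔ true)
      ≡⟨ sum-cong-≗ term ⟩
    sum (λ y → ⟦ does (x Fin.≟ y) ⟧ * g S + ⟦ lookup S y ⟧ * exchange x y)
      ≡⟨ ∑-distrib-+ {v} _ _ ⟩
    sum (λ y → ⟦ does (x Fin.≟ y) ⟧ * g S) + sum (λ y → ⟦ lookup S y ⟧ * exchange x y)
      ≡⟨ cong (_+ sum (λ y → ⟦ lookup S y ⟧ * exchange x y)) (∑-δ x (const (g S))) ⟩
    g S + sum (λ y → ⟦ lookup S y ⟧ * exchange x y)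
      ∎
    where
    open ≡-Reasoning
    term : ∀ y → ⟦ lookup (S [ x ]≔ true) y ⟧ * g ((S [ x ]≔ true) [ y ]≔ false)
                   ≡ ⟦ does (x Fin.≟ y) ⟧ * g S + ⟦ lookup S y ⟧ * exchange x y
    term y with x Fin.≟ y
    ... | yes refl rewrite VecP.lookup∘update x S true | VecP.[]≔-idempotent {x = true} {y = false} S x
                         | []≔-fixed S x x∉S | x∉S = sym (ℤP.+-identityʳ _)
    ... | no x≢y rewrite VecP.lookup∘update′ (x≢y ∘ sym) S true
                       | VecP.[]≔-commutes {x = true} {y = false} S x y x≢y = sym (ℤP.+-identityˡ _)

  down-after-remove : ∀ y → lookup S y ≡ true →
                      down g (S [ y ]≔ false) ≡ g S + sum (λ x → ⟦ not (lookup S x) ⟧ * exchange x y)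
  down-after-remove y y∈S = begin
    down g (S [ y ]≔ false)
      ≡⟨ sum-cong-≗ term ⟩
    sum (λ x → ⟦ does (y Fin.≟ x) ⟧ * g S + ⟦ not (lookup S x) ⟧ * exchange x y)
      ≡⟨ ∑-distrib-+ {v} _ _ ⟩
    sum (λ x → ⟦ does (y Fin.≟ x) ⟧ * g S) + sum (λ x → ⟦ not (lookup S x) ⟧ * exchange x y)
      ≡⟨ cong (_+ sum (λ x → ⟦ not (lookup S x) ⟧ * exchange x y)) (∑-δ y (const (g S))) ⟩
    g S + sum (λ x → ⟦ not (lookup S x) ⟧ * exchange x y)
      ∎
    where
    open ≡-Reasoning
    term : ∀ x → ⟦ not (lookup (S [ y ]≔ false) x) ⟧ * g ((S [ y ]≔ false) [ x ]≔ true)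
                   ≡ ⟦ does (y Fin.≟ x) ⟧ * g S + ⟦ not (lookup S x) ⟧ * exchange x y
    term x with y Fin.≟ x
    ... | yes refl rewrite VecP.lookup∘update y S false | VecP.[]≔-idempotent {x = false} {y = true} S y
                         | []≔-fixed S y y∈S | y∈S = sym (ℤP.+-identityʳ _)
    ... | no y≢x rewrite VecP.lookup∘update′ (y≢x ∘ sym) S false = sym (ℤP.+-identityˡ _)

  down-up-commutator : down (up g) S ≡ up (down g) S + (+ v - + ∣ S ∣ - + ∣ S ∣) * g S
  down-up-commutator = begin
    down (up g) S
      ≡⟨ sum-cong-≗ (λ x → ⟦⟧*-cong (not (lookup S x)) (up-after-insert x ∘ BoolP.not-injective)) ⟩
    sum (λ x → out x * (g S + sum (λ y → in′ y * exchange x y)))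
      ≡⟨ ∑-*-+ out (g S) (λ x → sum (λ y → in′ y * exchange x y)) ⟩
    sum out * g S + X
      ≡⟨ cong (λ c → c * g S + X) (count-∉ S) ⟩
    (+ v - + ∣ S ∣) * g S + X
      ≡⟨ rearrange (+ v) (+ ∣ S ∣) (g S) X ⟩
    (+ ∣ S ∣ * g S + X) + shift
      ≡⟨ cong (λ c → (c * g S + X) + shift) (count-∈ S) ⟨
    (sum in′ * g S + X) + shift
      ≡⟨ cong (λ z → (sum in′ * g S + z) + shift) (∑-*-∑-comm out in′ exchange) ⟨
    (sum in′ * g S + sum (λ y → in′ y * sum (λ x → out x * exchange x y))) + shift
      ≡⟨ cong (_+ shift) (∑-*-+ in′ (g S) (λ y → sum (λ x → out x * exchange x y))) ⟨
    sum (λ y → in′ y * (g S + sum (λ x → out x * exchange x y))) + shift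
      ≡⟨ cong (_+ shift) (sum-cong-≗ (λ y → ⟦⟧*-cong (lookup S y) (down-after-remove y))) ⟨
    up (down g) S + shift
      ∎
    where
    open ≡-Reasoning
    out in′ : Fin v → ℤ
    out x = ⟦ not (lookup S x) ⟧
    in′ y = ⟦ lookup S y ⟧
    X shift : ℤ
    X = sum (λ x → out x * sum (λ y → in′ y * exchange x y))
    shift = (+ v - + ∣ S ∣ - + ∣ S ∣) * g S
    rearrange : ∀ n s a x → (n - s) * a + x ≡ (s * a + x) + (n - s - s) * a
    rearrange = solve-∀

Homogeneous : ∀ {v} → ℕ → (Subset v → ℤ) → Set
Homogeneous t f = ∀ S → ∣ S ∣ ≢ t → f S ≡ 0ℤ

homogeneous-weight : ∀ {v t} {f : Subset v → ℤ} → Homogeneous t f →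
                     ∀ (c : ℕ → ℤ) S → c ∣ S ∣ * f S ≡ c t * f S
homogeneous-weight {t = t} hom c S with ∣ S ∣ ℕ.≟ t
... | yes refl = refl
... | no ∣S∣≢t rewrite hom S ∣S∣≢t = trans (ℤP.*-zeroʳ (c ∣ S ∣)) (sym (ℤP.*-zeroʳ (c t)))

up-homogeneous : ∀ {v t} {f : Subset v → ℤ} → Homogeneous t f → Homogeneous (suc t) (up f)
up-homogeneous hom K ∣K∣≢1+t = sum-vanishing λ x → ⟦⟧*-vanishing (lookup K x) λ x∈K →
  hom (K [ x ]≔ false) (λ ∣K-x∣≡t → ∣K∣≢1+t (trans (∣remove∣ K x x∈K) (cong suc ∣K-x∣≡t)))

upⁿ-homogeneous : ∀ {v t} {f : Subset v → ℤ} → Homogeneous t f → ∀ m → Homogeneous (m ℕ.+ t) (upⁿ m f)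
upⁿ-homogeneous hom zero = hom
upⁿ-homogeneous hom (suc m) = up-homogeneous (upⁿ-homogeneous hom m)

down-homogeneous : ∀ {v t} {f : Subset v → ℤ} → Homogeneous (suc t) f → Homogeneous t (down f)
down-homogeneous hom S ∣S∣≢t = sum-vanishing λ x → ⟦⟧*-vanishing (not (lookup S x)) λ x∉S →
  hom (S [ x ]≔ true) λ ∣S+x∣≡1+t →
    ∣S∣≢t (ℕP.suc-injective (trans (sym (∣insert∣ S x (BoolP.not-injective x∉S))) ∣S+x∣≡1+t))

down-homogeneous₀ : ∀ {v} {f : Subset v → ℤ} → Homogeneous 0 f → down f ≗ const 0ℤ
down-homogeneous₀ hom S = sum-vanishing λ x → ⟦⟧*-vanishing (not (lookup S x)) λ x∉S →
  hom (S [ x ]≔ true) λ ∣S+x∣≡0 →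
    ℕP.1+n≢0 (trans (sym (∣insert∣ S x (BoolP.not-injective x∉S))) ∣S+x∣≡0)

commutator-coefficient : ℕ → ℕ → ℕ → ℤ
commutator-coefficient v t j = + suc j * (+ v - + t - + t - + j)

down-upⁿ : ∀ {v t} {f : Subset v → ℤ} → Homogeneous t f → ∀ j S →
           down (upⁿ (suc j) f) S ≡ upⁿ (suc j) (down f) S + commutator-coefficient v t j * upⁿ j f S
down-upⁿ {v} {t} {f} hom zero S = begin
  down (up f) S
    ≡⟨ down-up-commutator f S ⟩
  up (down f) S + (+ v - + ∣ S ∣ - + ∣ S ∣) * f S
    ≡⟨ cong (_+_ (up (down f) S)) (homogeneous-weight hom (λ s → + v - + s - + s) S) ⟩
  up (down f) S + (+ v - + t - + t) * f S
    ≡⟨ cong (λ c → up (down f) S + c * f S) (coefficient (+ v - + t - + t)) ⟩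
  up (down f) S + commutator-coefficient v t 0 * f S
    ∎
  where
  open ≡-Reasoning
  coefficient : ∀ a → a ≡ 1ℤ * (a - 0ℤ)
  coefficient = solve-∀
down-upⁿ {v} {t} {f} hom (suc j) S = begin
  down (up g) S
    ≡⟨ down-up-commutator g S ⟩
  up (down g) S + (+ v - + ∣ S ∣ - + ∣ S ∣) * g S
    ≡⟨ cong₂ _+_ up-down-g (homogeneous-weight (upⁿ-homogeneous hom (suc j)) (λ s → + v - + s - + s) S) ⟩
  upⁿ (suc (suc j)) (down f) S + c * g S + (+ v - + (suc j ℕ.+ t) - + (suc j ℕ.+ t)) * g S
    ≡⟨ cong (λ z → upⁿ (suc (suc j)) (down f) S + c * g S + (+ v - z - z) * g S) (ℤP.pos-+ (suc j) t) ⟩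
  upⁿ (suc (suc j)) (down f) S + c * g S + (+ v - (+ suc j + + t) - (+ suc j + + t)) * g S
    ≡⟨ coefficient (upⁿ (suc (suc j)) (down f) S) (g S) (+ v) (+ t) (+ j) ⟩
  upⁿ (suc (suc j)) (down f) S + commutator-coefficient v t (suc j) * g S
    ∎
  where
  open ≡-Reasoning
  g = upⁿ (suc j) f
  c = commutator-coefficient v t j
  up-down-g : up (down g) S ≡ upⁿ (suc (suc j)) (down f) S + c * g S
  up-down-g = begin
    up (down g) S
      ≡⟨ up-cong (down-upⁿ hom j) S ⟩
    up (λ S′ → upⁿ (suc j) (down f) S′ + c * upⁿ j f S′) S
      ≡⟨ up-+ (upⁿ (suc j) (down f)) (λ S′ → c * upⁿ j f S′) S ⟩
    upⁿ (suc (suc j)) (down f) S + up (λ S′ → c * upⁿ j f S′) S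
      ≡⟨ cong (_+_ (upⁿ (suc (suc j)) (down f) S)) (up-* c (upⁿ j f) S) ⟩
    upⁿ (suc (suc j)) (down f) S + c * g S
      ∎
  coefficient : ∀ A B V T J →
    A + (1ℤ + J) * (V - T - T - J) * B + (V - ((1ℤ + J) + T) - ((1ℤ + J) + T)) * B
      ≡ A + (1ℤ + (1ℤ + J)) * (V - T - T - (1ℤ + J)) * B
  coefficient = solve-∀

commutator-coefficient-nonzero : ∀ v t j → t ℕ.+ t ℕ.+ suc j ≤ v → commutator-coefficient v t j ≢ 0ℤ
commutator-coefficient-nonzero v t j bound c≡0 with ℤP.i*j≡0⇒i≡0∨j≡0 (+ suc j) c≡0
... | inj₁ ()
... | inj₂ difference≡0 =
  ℕP.<-irrefl 2t+j≡v (ℕP.≤-trans (ℕP.≤-reflexive (sym (ℕP.+-suc (t ℕ.+ t) j))) bound)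
  where
  regroup : ∀ V T J → V - T - T - J ≡ V - (T + T + J)
  regroup = solve-∀
  2t+j≡v : t ℕ.+ t ℕ.+ j ≡ v
  2t+j≡v = sym (ℤP.+-injective (ℤP.i-j≡0⇒i≡j (+ v) (+ (t ℕ.+ t ℕ.+ j)) (begin
    + v - + (t ℕ.+ t ℕ.+ j) ≡⟨ cong (λ z → + v - z) (trans (ℤP.pos-+ (t ℕ.+ t) j) (cong (_+ + j) (ℤP.pos-+ t t))) ⟩
    + v - (+ t + + t + + j) ≡⟨ regroup (+ v) (+ t) (+ j) ⟨
    + v - + t - + t - + j   ≡⟨ difference≡0 ⟩
    0ℤ                      ∎)))
    where open ≡-Reasoning

module _ {v t} {f : Subset v → ℤ} (hom : Homogeneous t f) {j} (upⁿf≗0 : upⁿ (suc j) f ≗ const 0ℤ) where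

  private
    c = commutator-coefficient v t j

    relation : ∀ S → upⁿ (suc j) (down f) S + c * upⁿ j f S ≡ 0ℤ
    relation S = trans (sym (down-upⁿ hom j S)) (down-vanishing upⁿf≗0 S)

  upⁿ-down-vanishing : upⁿ (suc (suc j)) (down f) ≗ const 0ℤ
  upⁿ-down-vanishing S = begin
    up (upⁿ (suc j) (down f)) S
      ≡⟨ up-cong (λ S′ → solve-for (upⁿ (suc j) (down f) S′) c (upⁿ j f S′) (relation S′)) S ⟩
    up (λ S′ → - c * upⁿ j f S′) S
      ≡⟨ up-* (- c) (upⁿ j f) S ⟩
    - c * upⁿ (suc j) f S
      ≡⟨ cong (- c *_) (upⁿf≗0 S) ⟩
    - c * 0ℤ
      ≡⟨ ℤP.*-zeroʳ (- c) ⟩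
    0ℤ
      ∎
    where
    open ≡-Reasoning
    regroup : ∀ a c b → a ≡ (a + c * b) + - c * b
    regroup = solve-∀
    solve-for : ∀ a c b → a + c * b ≡ 0ℤ → a ≡ - c * b
    solve-for a c b e = trans (regroup a c b) (trans (cong (_+ - c * b) e) (ℤP.+-identityˡ (- c * b)))

  upⁿ-lower : t ℕ.+ t ℕ.+ suc j ≤ v → down f ≗ const 0ℤ → upⁿ j f ≗ const 0ℤ
  upⁿ-lower bound down-f≗0 S with ℤP.i*j≡0⇒i≡0∨j≡0 c c*upⁿf≡0
    where
    c*upⁿf≡0 : c * upⁿ j f S ≡ 0ℤ
    c*upⁿf≡0 = trans (sym (ℤP.+-identityˡ _))
                 (trans (cong (_+ c * upⁿ j f S) (sym (upⁿ-vanishing (suc j) down-f≗0 S))) (relation S))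
  ... | inj₁ c≡0 = contradiction c≡0 (commutator-coefficient-nonzero v t j bound)
  ... | inj₂ upⁿf≡0 = upⁿf≡0

-- Lexicographic induction on (t, m): down f has degree t - 1 and is killed by upⁿ (m + 1),
-- so it vanishes; the commutation relation then kills upⁿ (m - 1) f.
upⁿ-injective : ∀ {v} t m {f : Subset v → ℤ} → Homogeneous t f → t ℕ.+ t ℕ.+ m ≤ v →
                upⁿ m f ≗ const 0ℤ → f ≗ const 0ℤ
upⁿ-injective t zero hom bound upⁿf≗0 = upⁿf≗0
upⁿ-injective zero (suc j) hom bound upⁿf≗0 =
  upⁿ-injective zero j hom (ℕP.≤-trans (ℕP.n≤1+n j) bound)
    (upⁿ-lower hom {j} upⁿf≗0 bound (down-homogeneous₀ hom))
upⁿ-injective {v} (suc t) (suc j) hom bound upⁿf≗0 =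
  upⁿ-injective (suc t) j hom bound′ (upⁿ-lower hom {j} upⁿf≗0 bound
    (upⁿ-injective t (suc (suc j)) (down-homogeneous hom) (subst (_≤ v) (regroup t j) bound′)
      (upⁿ-down-vanishing hom {j} upⁿf≗0)))
  where
  bound′ = ℕP.≤-trans (ℕP.+-monoʳ-≤ (suc t ℕ.+ suc t) (ℕP.n≤1+n j)) bound
  regroup : ∀ t j → suc t ℕ.+ suc t ℕ.+ j ≡ t ℕ.+ t ℕ.+ suc (suc j)
  regroup = ℕ-solve-∀

upⁿ-injective-to-layer : ∀ {v t k} {f : Subset v → ℤ} → Homogeneous t f → t ≤ k → t ℕ.+ k ≤ v →
                         (∀ K → ∣ K ∣ ≡ k → upⁿ (k ∸ t) f K ≡ 0ℤ) → f ≗ const 0ℤ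
upⁿ-injective-to-layer {v} {t} {k} {f} hom t≤k t+k≤v vanishes-on-layer =
  upⁿ-injective t (k ∸ t) hom bound vanishes
  where
  bound : t ℕ.+ t ℕ.+ (k ∸ t) ≤ v
  bound = subst (_≤ v) (trans (cong (t ℕ.+_) (sym (ℕP.m+[n∸m]≡n t≤k))) (sym (ℕP.+-assoc t t (k ∸ t))))
                t+k≤v
  vanishes : upⁿ (k ∸ t) f ≗ const 0ℤ
  vanishes K with ∣ K ∣ ℕ.≟ k
  ... | yes ∣K∣≡k = vanishes-on-layer K ∣K∣≡k
  ... | no ∣K∣≢k = upⁿ-homogeneous hom (k ∸ t) K (∣K∣≢k ∘ flip′ trans (ℕP.m∸n+n≡m t≤k))

relabel : ∀ {v} → Permutation′ v → Subset v → Subset v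
relabel π K = tabulate (λ y → lookup K (π ⟨$⟩ˡ y))

module _ {v} (π : Permutation′ v) where

  lookup-relabel : ∀ K y → lookup (relabel π K) y ≡ lookup K (π ⟨$⟩ˡ y)
  lookup-relabel K = VecP.lookup∘tabulate _

  lookup-relabel-image : ∀ K x → lookup (relabel π K) (π ⟨$⟩ʳ x) ≡ lookup K x
  lookup-relabel-image K x = trans (lookup-relabel K (π ⟨$⟩ʳ x)) (cong (lookup K) (inverseˡ π))

  ∈-relabel⁺ : ∀ {K x} → x ∈ K → π ⟨$⟩ʳ x ∈ relabel π K
  ∈-relabel⁺ {K} {x} x∈K = VecP.lookup⇒[]= _ _ (trans (lookup-relabel-image K x) (VecP.[]=⇒lookup x∈K))

  ∈-relabel⁻ : ∀ {K y} → y ∈ relabel π K → π ⟨$⟩ˡ y ∈ K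
  ∈-relabel⁻ {K} {y} y∈πK = VecP.lookup⇒[]= _ _ (trans (sym (lookup-relabel K y)) (VecP.[]=⇒lookup y∈πK))

  relabel-⊆ : ∀ {T K} → T ⊆ K → relabel π T ⊆ relabel π K
  relabel-⊆ T⊆K y∈πT = subst (_∈ _) (inverseʳ π) (∈-relabel⁺ (T⊆K (∈-relabel⁻ y∈πT)))

  relabel-[]≔ : ∀ K x b → relabel π K [ π ⟨$⟩ʳ x ]≔ b ≡ relabel π (K [ x ]≔ b)
  relabel-[]≔ K x b = lookup-ext λ y → trans (entry y) (sym (lookup-relabel (K [ x ]≔ b) y))
    where
    entry : ∀ y → lookup (relabel π K [ π ⟨$⟩ʳ x ]≔ b) y ≡ lookup (K [ x ]≔ b) (π ⟨$⟩ˡ y)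
    entry y with y Fin.≟ π ⟨$⟩ʳ x
    ... | yes refl = trans (VecP.lookup∘update (π ⟨$⟩ʳ x) (relabel π K) b)
                           (sym (trans (cong (lookup (K [ x ]≔ b)) (inverseˡ π)) (VecP.lookup∘update x K b)))
    ... | no y≢πx = begin
      lookup (relabel π K [ π ⟨$⟩ʳ x ]≔ b) y ≡⟨ VecP.lookup∘update′ y≢πx (relabel π K) b ⟩
      lookup (relabel π K) y                ≡⟨ lookup-relabel K y ⟩
      lookup K (π ⟨$⟩ˡ y)                   ≡⟨ VecP.lookup∘update′ π⁻¹y≢x K b ⟨
      lookup (K [ x ]≔ b) (π ⟨$⟩ˡ y)        ∎
      where
      open ≡-Reasoning
      π⁻¹y≢x : π ⟨$⟩ˡ y ≢ x
      π⁻¹y≢x π⁻¹y≡x = y≢πx (trans (sym (inverseʳ π)) (cong (π ⟨$⟩ʳ_) π⁻¹y≡x))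

  relabel-flip : ∀ K → relabel (flip π) (relabel π K) ≡ K
  relabel-flip K = lookup-ext λ y → trans (VecP.lookup∘tabulate _ y) (lookup-relabel-image K y)

  ∣relabel∣ : ∀ K → ∣ relabel π K ∣ ≡ ∣ K ∣
  ∣relabel∣ K = ℤP.+-injective (begin
    + ∣ relabel π K ∣                               ≡⟨ count-∈ (relabel π K) ⟨
    sum (λ y → ⟦ lookup (relabel π K) y ⟧)          ≡⟨ sum-permute _ π ⟩
    sum (λ x → ⟦ lookup (relabel π K) (π ⟨$⟩ʳ x) ⟧) ≡⟨ sum-cong-≗ (cong ⟦_⟧ ∘ lookup-relabel-image K) ⟩
    sum (λ x → ⟦ lookup K x ⟧)                      ≡⟨ count-∈ K ⟩
    + ∣ K ∣                                         ∎)
    where open ≡-Reasoning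

  up-relabel : ∀ (f : Subset v → ℤ) K → up f (relabel π K) ≡ up (f ∘ relabel π) K
  up-relabel f K = begin
    up f (relabel π K)
      ≡⟨ sum-permute _ π ⟩
    sum (λ x → ⟦ lookup (relabel π K) (π ⟨$⟩ʳ x) ⟧ * f (relabel π K [ π ⟨$⟩ʳ x ]≔ false))
      ≡⟨ sum-cong-≗ (λ x → cong₂ (λ b T → ⟦ b ⟧ * f T) (lookup-relabel-image K x) (relabel-[]≔ K x false)) ⟩
    up (f ∘ relabel π) K
      ∎
    where open ≡-Reasoning

  upⁿ-relabel : ∀ m (f : Subset v → ℤ) K → upⁿ m f (relabel π K) ≡ upⁿ m (f ∘ relabel π) K
  upⁿ-relabel zero f K = refl
  upⁿ-relabel (suc m) f K = trans (up-relabel (upⁿ m f) K) (up-cong (upⁿ-relabel m f) K)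

relabel-∘ : ∀ {v} (π ρ : Permutation′ v) K → relabel (π ∘ₚ ρ) K ≡ relabel ρ (relabel π K)
relabel-∘ π ρ K = lookup-ext λ y → trans (VecP.lookup∘tabulate _ y)
  (sym (trans (lookup-relabel ρ (relabel π K) y) (lookup-relabel π K (ρ ⟨$⟩ˡ y))))

relabel-id : ∀ {v} (K : Subset v) → relabel Perm.id K ≡ K
relabel-id K = lookup-ext (VecP.lookup∘tabulate (lookup K))

≈⇒≈ˡ : ∀ {v} (π ρ : Permutation′ v) → π Perm.≈ ρ → ∀ y → π ⟨$⟩ˡ y ≡ ρ ⟨$⟩ˡ y
≈⇒≈ˡ π ρ π≈ρ y = begin
  π ⟨$⟩ˡ y                  ≡⟨ inverseˡ ρ ⟨
  ρ ⟨$⟩ˡ (ρ ⟨$⟩ʳ (π ⟨$⟩ˡ y)) ≡⟨ cong (ρ ⟨$⟩ˡ_) (π≈ρ (π ⟨$⟩ˡ y)) ⟨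
  ρ ⟨$⟩ˡ (π ⟨$⟩ʳ (π ⟨$⟩ˡ y)) ≡⟨ cong (ρ ⟨$⟩ˡ_) (inverseʳ π) ⟩
  ρ ⟨$⟩ˡ y                  ∎
  where open ≡-Reasoning

relabel-cong : ∀ {v} (π ρ : Permutation′ v) → π Perm.≈ ρ → ∀ K → relabel π K ≡ relabel ρ K
relabel-cong π ρ π≈ρ K = VecP.tabulate-cong (cong (lookup K) ∘ ≈⇒≈ˡ π ρ π≈ρ)

∃-vector? : ∀ {m n} {P : Vec (Fin m) n → Set} → (∀ xs → Dec (P xs)) → Dec (∃ P)
∃-vector? {n = zero} P? = map′ ([] ,_) (λ { ([] , p) → p }) (P? [])
∃-vector? {n = suc n} P? = map′ (λ (x , xs , p) → x ∷ xs , p) (λ { (x ∷ xs , p) → x , xs , p })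
  (FinP.any? λ x → ∃-vector? (P? ∘ (x ∷_)))

Inverses : ∀ {v} → Vec (Fin v) v → Vec (Fin v) v → Set
Inverses σ τ = (∀ x → lookup τ (lookup σ x) ≡ x) × (∀ y → lookup σ (lookup τ y) ≡ y)

inverses? : ∀ {v} (σ τ : Vec (Fin v) v) → Dec (Inverses σ τ)
inverses? σ τ =
  FinP.all? (λ x → lookup τ (lookup σ x) Fin.≟ x) ×-dec FinP.all? (λ y → lookup σ (lookup τ y) Fin.≟ y)

fromInverses : ∀ {v} (σ τ : Vec (Fin v) v) → Inverses σ τ → Permutation′ v
fromInverses σ τ (τσ≗id , στ≗id) = permutation (lookup σ) (lookup τ) στ≗id τσ≗id

tabulate-Inverses : ∀ {v} (π : Permutation′ v) → Inverses (tabulate (π ⟨$⟩ʳ_)) (tabulate (π ⟨$⟩ˡ_))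
tabulate-Inverses {v} π = inverse π (λ _ → inverseˡ π) , inverse (flip π) (λ _ → inverseʳ π)
  where
  inverse : ∀ (ρ : Permutation′ v) → (∀ x → ρ ⟨$⟩ˡ (ρ ⟨$⟩ʳ x) ≡ x) →
            ∀ x → lookup (tabulate (ρ ⟨$⟩ˡ_)) (lookup (tabulate (ρ ⟨$⟩ʳ_)) x) ≡ x
  inverse ρ ρ⁻¹ρ≗id x = trans (VecP.lookup∘tabulate (ρ ⟨$⟩ˡ_) _)
    (trans (cong (ρ ⟨$⟩ˡ_) (VecP.lookup∘tabulate (ρ ⟨$⟩ʳ_) x)) (ρ⁻¹ρ≗id x))

∃-permutation? : ∀ {v} {P : Permutation′ v → Set} → (∀ π ρ → π Perm.≈ ρ → P π → P ρ) →
                 (∀ π → Dec (P π)) → Dec (∃ P)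
∃-permutation? {v} {P} resp P? = map′ (λ (σ , τ , inv , p) → fromInverses σ τ inv , p) tabulated
  (∃-vector? λ σ → ∃-vector? λ τ → candidate σ τ)
  where
  Candidate : Vec (Fin v) v → Vec (Fin v) v → Set
  Candidate σ τ = Σ (Inverses σ τ) (P ∘ fromInverses σ τ)
  candidate : ∀ σ τ → Dec (Candidate σ τ)
  candidate σ τ with inverses? σ τ
  ... | no ¬inv = no (¬inv ∘ proj₁)
  ... | yes inv = map′ (inv ,_) (λ (inv′ , p) → resp (fromInverses σ τ inv′) _ (λ _ → refl) p)
                       (P? (fromInverses σ τ inv))
  tabulated : ∃ P → ∃₂ Candidate
  tabulated (π , p) = tabulate (π ⟨$⟩ʳ_) , tabulate (π ⟨$⟩ˡ_) , tabulate-Inverses π ,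
                      resp π _ (λ x → sym (VecP.lookup∘tabulate (π ⟨$⟩ʳ_) x)) p

Elem-≡ : ∀ {v} {K : Subset v} {e e′ : Elem K} → proj₁ e ≡ proj₁ e′ → e ≡ e′
Elem-≡ {e = x , x∈K} {.x , x∈K′} refl = cong (x ,_) ([]=-irrelevant x∈K x∈K′)

module _ {v} {K : Subset v} where

  extendMap : (Elem K → Elem K) → Fin v → Fin v
  extendMap f x with x ∈? K
  ... | yes x∈K = proj₁ (f (x , x∈K))
  ... | no _ = x

  extendMap-elem : ∀ f (e : Elem K) → extendMap f (proj₁ e) ≡ proj₁ (f e)
  extendMap-elem f (x , x∈K) with x ∈? K
  ... | yes x∈K′ = cong (proj₁ ∘ f) (Elem-≡ refl)
  ... | no x∉K = contradiction x∈K x∉K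

  extendMap-∉ : ∀ f {x} → x ∉ K → extendMap f x ≡ x
  extendMap-∉ f {x} x∉K with x ∈? K
  ... | yes x∈K = contradiction x∈K x∉K
  ... | no _ = refl

  extendMap-inverse : ∀ f g → (∀ e → f (g e) ≡ e) → ∀ x → extendMap f (extendMap g x) ≡ x
  extendMap-inverse f g fg≗id x with x ∈? K
  ... | yes x∈K = trans (extendMap-elem f (g (x , x∈K))) (cong proj₁ (fg≗id (x , x∈K)))
  ... | no x∉K = extendMap-∉ f x∉K

  lookup-extendMap : ∀ f x → lookup K (extendMap f x) ≡ lookup K x
  lookup-extendMap f x with x ∈? K
  ... | yes x∈K = trans (VecP.[]=⇒lookup (proj₂ (f (x , x∈K)))) (sym (VecP.[]=⇒lookup x∈K))
  ... | no _ = refl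

  extend : Elem K ↔ Elem K → Permutation′ v
  extend F = permutation (extendMap (Inverse.to F)) (extendMap (Inverse.from F))
    (extendMap-inverse _ _ (Inverse.strictlyInverseˡ F)) (extendMap-inverse _ _ (Inverse.strictlyInverseʳ F))

  relabel-extend : ∀ F → relabel (extend F) K ≡ K
  relabel-extend F = lookup-ext λ y → trans (lookup-relabel (extend F) K y) (lookup-extendMap (Inverse.from F) y)

record IsoOn {v} (T : Subset v) (H H′ : Graph v) (π : Permutation′ v) (b : Bool) : Set where
  constructor isoOn
  field
    edge : ∀ {x y} → x ∈ T → y ∈ T → x ≢ y → adj H x y ≡ b xor adj H′ (π ⟨$⟩ʳ x) (π ⟨$⟩ʳ y)
open IsoOn

isoOn? : ∀ {v} T (H H′ : Graph v) π b → Dec (IsoOn T H H′ π b)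
isoOn? T H H′ π b = map′ (λ edges → isoOn (edges _ _)) (λ iso _ _ → edge iso)
  (FinP.all? λ x → FinP.all? λ y → (x ∈? T) →-dec ((y ∈? T) →-dec (¬? (x Fin.≟ y) →-dec
    (adj H x y BoolP.≟ (b xor adj H′ (π ⟨$⟩ʳ x) (π ⟨$⟩ʳ y))))))

module _ {v} {H H′ : Graph v} where

  IsoOn-⊆ : ∀ {T K π b} → T ⊆ K → IsoOn K H H′ π b → IsoOn T H H′ π b
  IsoOn-⊆ T⊆K iso = isoOn λ x∈T y∈T → edge iso (T⊆K x∈T) (T⊆K y∈T)

  IsoOn-cong : ∀ {T b} π ρ → π Perm.≈ ρ → IsoOn T H H′ π b → IsoOn T H H′ ρ b
  IsoOn-cong {b = b} π ρ π≈ρ iso = isoOn λ {x} {y} x∈T y∈T x≢y →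
    trans (edge iso x∈T y∈T x≢y) (cong₂ (λ a c → b xor adj H′ a c) (π≈ρ x) (π≈ρ y))

  IsoOn-∘ : ∀ {H″ T π ρ b c} → IsoOn T H H′ π b → IsoOn (relabel π T) H′ H″ ρ c →
            IsoOn T H H″ (π ∘ₚ ρ) (b xor c)
  IsoOn-∘ {H″} {π = π} {ρ} {b} {c} iso iso′ = isoOn λ {x} {y} x∈T y∈T x≢y → begin
    adj H x y
      ≡⟨ edge iso x∈T y∈T x≢y ⟩
    b xor adj H′ (π ⟨$⟩ʳ x) (π ⟨$⟩ʳ y)
      ≡⟨ cong (b xor_) (edge iso′ (∈-relabel⁺ π x∈T) (∈-relabel⁺ π y∈T) (x≢y ∘ Injection.injective (↔⇒↣ π))) ⟩
    b xor (c xor adj H″ (ρ ⟨$⟩ʳ (π ⟨$⟩ʳ x)) (ρ ⟨$⟩ʳ (π ⟨$⟩ʳ y)))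
      ≡⟨ BoolP.xor-assoc b c _ ⟨
    (b xor c) xor adj H″ (ρ ⟨$⟩ʳ (π ⟨$⟩ʳ x)) (ρ ⟨$⟩ʳ (π ⟨$⟩ʳ y))
      ∎
    where open ≡-Reasoning

  IsoOn-flip : ∀ {T π b} → IsoOn T H H′ π b → IsoOn (relabel π T) H′ H (flip π) b
  IsoOn-flip {π = π} {b} iso = isoOn λ {x} {y} x∈πT y∈πT x≢y → xor-swap b (begin
    adj H (π ⟨$⟩ˡ x) (π ⟨$⟩ˡ y)
      ≡⟨ edge iso (∈-relabel⁻ π x∈πT) (∈-relabel⁻ π y∈πT) (x≢y ∘ Injection.injective (↔⇒↣ (flip π))) ⟩
    b xor adj H′ (π ⟨$⟩ʳ (π ⟨$⟩ˡ x)) (π ⟨$⟩ʳ (π ⟨$⟩ˡ y))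
      ≡⟨ cong₂ (λ a c → b xor adj H′ a c) (inverseʳ π) (inverseʳ π) ⟩
    b xor adj H′ x y
      ∎)
    where
    open ≡-Reasoning
    xor-swap : ∀ b {a c} → a ≡ b xor c → c ≡ b xor a
    xor-swap false refl = refl
    xor-swap true {c = c} refl = sym (BoolP.not-involutive c)

module _ {v} {G H′ : Graph v} (H : Graph v) b (complemented : ∀ x y → adj H′ x y ≡ b xor adj H x y) where

  IsoOn⇒InducedIso : ∀ {K π} → relabel π K ≡ K → IsoOn K G H π b → InducedIso G H′ K
  IsoOn⇒InducedIso {K} {π} πK≡K iso = restriction , λ (x , x∈K) (y , y∈K) x≢y →
    trans (edge iso x∈K y∈K x≢y) (sym (complemented (π ⟨$⟩ʳ x) (π ⟨$⟩ʳ y)))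
    where
    restriction : Elem K ↔ Elem K
    restriction = mk↔ₛ′
      (λ (x , x∈K) → π ⟨$⟩ʳ x , subst (π ⟨$⟩ʳ x ∈_) πK≡K (∈-relabel⁺ π x∈K))
      (λ (y , y∈K) → π ⟨$⟩ˡ y , ∈-relabel⁻ π (subst (y ∈_) (sym πK≡K) y∈K))
      (λ _ → Elem-≡ (inverseʳ π)) (λ _ → Elem-≡ (inverseˡ π))

  InducedIso⇒IsoOn : ∀ {K} → InducedIso G H′ K → ∃ λ π → relabel π K ≡ K × IsoOn K G H π b
  InducedIso⇒IsoOn {K} (F , iso) = extend F , relabel-extend F , isoOn λ {x} {y} x∈K y∈K x≢y → begin
    adj G x y
      ≡⟨ iso (x , x∈K) (y , y∈K) x≢y ⟩
    adj H′ (F⁺ (x , x∈K)) (F⁺ (y , y∈K))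
      ≡⟨ complemented _ _ ⟩
    b xor adj H (F⁺ (x , x∈K)) (F⁺ (y , y∈K))
      ≡⟨ cong₂ (λ a c → b xor adj H a c) (extendMap-elem _ (x , x∈K)) (extendMap-elem _ (y , y∈K)) ⟨
    b xor adj H (extend F ⟨$⟩ʳ x) (extend F ⟨$⟩ʳ y)
      ∎
    where
    open ≡-Reasoning
    F⁺ : Elem K → Fin v
    F⁺ = proj₁ ∘ Inverse.to F

IsoOn⇒InducedIsoUpToCompl : ∀ {v} {G H : Graph v} {K π} b → relabel π K ≡ K → IsoOn K G H π b →
                            InducedIsoUpToCompl G H K
IsoOn⇒InducedIsoUpToCompl {H = H} false πK≡K iso =
  inj₁ (IsoOn⇒InducedIso {H′ = H} H false (λ _ _ → refl) πK≡K iso)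
IsoOn⇒InducedIsoUpToCompl {H = H} true πK≡K iso =
  inj₂ (IsoOn⇒InducedIso {H′ = complement H} H true (λ _ _ → refl) πK≡K iso)

InducedIsoUpToCompl⇒IsoOn : ∀ {v} {G H : Graph v} {K} → InducedIsoUpToCompl G H K →
                            ∃₂ λ π b → relabel π K ≡ K × IsoOn K G H π b
InducedIsoUpToCompl⇒IsoOn {H = H} (inj₁ iso) =
  let π , fixed = InducedIso⇒IsoOn {H′ = H} H false (λ _ _ → refl) iso in π , false , fixed
InducedIsoUpToCompl⇒IsoOn {H = H} (inj₂ iso) =
  let π , fixed = InducedIso⇒IsoOn {H′ = complement H} H true (λ _ _ → refl) iso in π , true , fixed

InducedIsoUpToCompl-empty : ∀ {v} {G H : Graph v} {K} → ∣ K ∣ ≡ 0 → InducedIsoUpToCompl G H K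
InducedIsoUpToCompl-empty {G = G} {H} {K} ∣K∣≡0 =
  IsoOn⇒InducedIsoUpToCompl {G = G} {H} {π = Perm.id} false (relabel-id K) (isoOn λ {x} x∈K _ _ →
    contradiction (subst (∣ K Subset.- x ∣ ℕ.<_) ∣K∣≡0 (x∈p⇒∣p-x∣<∣p∣ x∈K)) ℕP.n≮0)

module Copies {v} (G : Graph v) (T₀ : Subset v) where

  Copy : Graph v → Subset v → Set
  Copy H T = ∃₂ λ π b → T ≡ relabel π T₀ × IsoOn T₀ G H π b

  copy? : ∀ H T → Dec (Copy H T)
  copy? H T = ∃-permutation? respects (∃-Bool? ∘ candidate)
    where
    candidate : ∀ π b → Dec (T ≡ relabel π T₀ × IsoOn T₀ G H π b)
    candidate π b = VecP.≡-dec BoolP._≟_ T (relabel π T₀) ×-dec isoOn? T₀ G H π b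
    respects : ∀ π ρ → π Perm.≈ ρ → (∃ λ b → T ≡ relabel π T₀ × IsoOn T₀ G H π b) →
               ∃ λ b → T ≡ relabel ρ T₀ × IsoOn T₀ G H ρ b
    respects π ρ π≈ρ (b , T≡πT₀ , iso) =
      b , trans T≡πT₀ (relabel-cong π ρ π≈ρ T₀) , IsoOn-cong π ρ π≈ρ iso

  copies : Graph v → Subset v → ℤ
  copies H T = ⟦ does (copy? H T) ⟧

  copies-homogeneous : ∀ H → Homogeneous ∣ T₀ ∣ (copies H)
  copies-homogeneous H T ∣T∣≢∣T₀∣ = cong ⟦_⟧ (dec-false (copy? H T)
    λ (π , _ , T≡πT₀ , _) → ∣T∣≢∣T₀∣ (trans (cong ∣_∣ T≡πT₀) (∣relabel∣ π T₀)))

  copies-difference-homogeneous : ∀ H H′ → Homogeneous ∣ T₀ ∣ (λ T → copies H T - copies H′ T)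
  copies-difference-homogeneous H H′ T ∣T∣≢∣T₀∣ =
    cong₂ _-_ (copies-homogeneous H T ∣T∣≢∣T₀∣) (copies-homogeneous H′ T ∣T∣≢∣T₀∣)

  copies-self : copies G T₀ ≡ 1ℤ
  copies-self = cong ⟦_⟧ (dec-true (copy? G T₀) (Perm.id , false , sym (relabel-id T₀) , isoOn λ _ _ _ → refl))

  Copy⇒InducedIsoUpToCompl : ∀ {H} → Copy H T₀ → InducedIsoUpToCompl G H T₀
  Copy⇒InducedIsoUpToCompl (π , b , T₀≡πT₀ , iso) = IsoOn⇒InducedIsoUpToCompl b (sym T₀≡πT₀) iso

  Copy-transport : ∀ {H H′ K T ρ c} → IsoOn K H H′ ρ c → T ⊆ K → Copy H T → Copy H′ (relabel ρ T)
  Copy-transport {ρ = ρ} {c} iso T⊆K (π , b , refl , copy) =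
    π ∘ₚ ρ , b xor c , sym (relabel-∘ π ρ T₀) , IsoOn-∘ copy (IsoOn-⊆ T⊆K iso)

  copies-relabel : ∀ {H H′ K ρ c} → IsoOn K H H′ ρ c →
                   ∀ {T} → T ⊆ K → copies H T ≡ copies H′ (relabel ρ T)
  copies-relabel {H} {H′} {ρ = ρ} iso {T} T⊆K = cong ⟦_⟧ (does-⇔ (Copy-transport iso T⊆K)
    (subst (Copy H) (relabel-flip ρ T) ∘ Copy-transport (IsoOn-flip iso) (relabel-⊆ ρ T⊆K))
    (copy? H T) (copy? H′ (relabel ρ T)))

  upⁿ-copies : ∀ {H H′ K} → InducedIsoUpToCompl H H′ K →
               ∀ m → upⁿ m (copies H) K ≡ upⁿ m (copies H′) K
  upⁿ-copies {H} {H′} {K} iso m with InducedIsoUpToCompl⇒IsoOn iso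
  ... | ρ , c , ρK≡K , ρ-iso = begin
    upⁿ m (copies H) K              ≡⟨ upⁿ-local m (copies-relabel ρ-iso) ⟩
    upⁿ m (copies H′ ∘ relabel ρ) K ≡⟨ upⁿ-relabel ρ m (copies H′) K ⟨
    upⁿ m (copies H′) (relabel ρ K) ≡⟨ cong (upⁿ m (copies H′)) ρK≡K ⟩
    upⁿ m (copies H′) K             ∎
    where open ≡-Reasoning

  upⁿ-copies-difference : ∀ {H H′ K} → InducedIsoUpToCompl H H′ K → ∀ m →
                          upⁿ m (λ T → copies H T - copies H′ T) K ≡ 0ℤ
  upⁿ-copies-difference {H} {H′} {K} iso m = begin
    upⁿ m (λ T → copies H T - copies H′ T) K  ≡⟨ upⁿ-distrib-minus m (copies H) (copies H′) K ⟩
    upⁿ m (copies H) K - upⁿ m (copies H′) K  ≡⟨ cong (_- upⁿ m (copies H′) K) (upⁿ-copies iso m) ⟩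
    upⁿ m (copies H′) K - upⁿ m (copies H′) K ≡⟨ ℤP.+-inverseʳ (upⁿ m (copies H′) K) ⟩
    0ℤ                                        ∎
    where open ≡-Reasoning

proposition2p4 : (v k t : ℕ) → t ≤ k ⊓ (v ∸ k) → (G G' : Graph v) →
    HypomorphicUpToCompl k G G' → HypomorphicUpToCompl t G G'
proposition2p4 v k .(∣ T₀ ∣) t≤k⊓[v∸k] G G' hyp T₀ refl with k ℕ.≤? v
... | no k≰v = InducedIsoUpToCompl-empty {G = G} {G'} (ℕP.n≤0⇒n≡0 (ℕP.≤-trans t≤k⊓[v∸k]
  (ℕP.≤-trans (ℕP.m⊓n≤n k (v ∸ k)) (ℕP.≤-reflexive (ℕP.m≤n⇒m∸n≡0 (ℕP.<⇒≤ (ℕP.≰⇒> k≰v)))))))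
... | yes k≤v =
  Copy⇒InducedIsoUpToCompl (⟦does⟧≡1⇒ (copy? G' T₀) (trans (sym copies-agree) copies-self))
  where
  open Copies G T₀
  copies-agree : copies G T₀ ≡ copies G' T₀
  copies-agree = ℤP.i-j≡0⇒i≡j _ _ (upⁿ-injective-to-layer (copies-difference-homogeneous G G')
    (ℕP.≤-trans t≤k⊓[v∸k] (ℕP.m⊓n≤m k (v ∸ k)))
    (ℕP.m≤o∸n⇒m+n≤o ∣ T₀ ∣ k≤v (ℕP.≤-trans t≤k⊓[v∸k] (ℕP.m⊓n≤n k (v ∸ k))))
    (λ K ∣K∣≡k → upⁿ-copies-difference (hyp K ∣K∣≡k) (k ∸ ∣ T₀ ∣)) T₀)
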